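{- Let $G:\mathbb{N}\times\mathbb{N}\to\mathbb{N}$ be defined by $$G(m,n)=\frac{1}{4}\left[(m+n+1)^2-\big((m+n+1)\bmod 2\big)\right]+\min(m,n).$$ For every $C\in\mathbb{N}$, the equation $G(m,n)=C$ has exactly one solution $(m,n)\in\mathbb{N}\times\mathbb{N}$ with $m\ge n$. Namely, letting $t=\lfloor\sqrt{C}\rfloor$, $a=\operatorname{sgn}(C-t^2)$, $b=\operatorname{sgn}'(t^2+t-C)$ and $c=\operatorname{sgn}(t)$, this solution is $$m=c\Big\{(2t-1)(1-a)+a\big[t(t+3)-(t+1)b-C\big]\Big\},\qquad n=c\,a\big[C-t(t+1-b)\big].$$
   Context: $\mathbb{N}=\{0,1,2,\dots\}$. For an integer $k$, $k\bmod 2$ denotes the least non-negative residue of $k$ modulo $2$. $\operatorname{sgn}$ is the usual signum function, and $\operatorname{sgn}'(x)=\frac{\operatorname{sgn}^2(x)+\operatorname{sgn}(x)}{2}$, i.e. $\operatorname{sgn}'(x)=0$ if $x\le 0$ and $\operatorname{sgn}'(x)=1$ if $x>0$. -}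

module Defs where

open import Data.Nat as ℕ using (ℕ; zero; suc; _∸_; _⊓_; _≤?_)
open import Data.Nat.DivMod using (_/_; _%_)
open import Data.Integer as ℤ using (ℤ; +_; -[1+_]; _-_; 1ℤ; 0ℤ; -1ℤ)
open import Relation.Nullary.Decidable using (does)
open import Data.Bool using (if_then_else_)

-- G(m,n) = ((m+n+1)^2 - ((m+n+1) mod 2)) / 4 + min(m,n)   (division is exact)
G : ℕ → ℕ → ℕ
G m n = ((s ℕ.* s) ∸ (s % 2)) / 4 ℕ.+ (m ⊓ n)
  where s = m ℕ.+ n ℕ.+ 1

floorSqrt : ℕ → ℕ
floorSqrt zero = zero
floorSqrt (suc C) with floorSqrt C
... | t = if does (suc t ℕ.* suc t ≤? suc C) then suc t else t

sgn : ℤ → ℤ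
sgn (+ zero)  = 0ℤ
sgn (+ suc _) = 1ℤ
sgn -[1+ _ ]  = -1ℤ

sgn′ : ℤ → ℤ
sgn′ (+ zero)  = 0ℤ
sgn′ (+ suc _) = 1ℤ
sgn′ -[1+ _ ]  = 0ℤ

module _ (C : ℕ) where
  private
    t : ℤ
    t = + floorSqrt C
    Cz : ℤ
    Cz = + C
    a b c : ℤ
    a = sgn (Cz - t ℤ.* t)
    b = sgn′ (t ℤ.* t ℤ.+ t - Cz)
    c = sgn t

  formulaM : ℤ
  formulaM = c ℤ.* ((+ 2 ℤ.* t - 1ℤ) ℤ.* (1ℤ - a)
                     ℤ.+ a ℤ.* (t ℤ.* (t ℤ.+ + 3) - (t ℤ.+ 1ℤ) ℤ.* b - Cz))

  formulaN : ℤ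
  formulaN = c ℤ.* a ℤ.* (Cz - t ℤ.* (t ℤ.+ 1ℤ - b))

-- Put s = m + n + 1. If m − n is odd then s = 2t and G m n = t² + n with n < t; if m − n is
-- even then s = 2t + 1 and G m n = t² + (t + n) with n ≤ t. Hence every C = t² + r with
-- r ≤ 2t, i.e. t = ⌊√C⌋, is hit by exactly one pair with m ≥ n: an odd gap if r < t, an even
-- gap if t ≤ r. The signs c, a, b in the closed formulas distinguish t = 0, r = 0, 0 < r < t
-- and t ≤ r, and on each of these cases the formulas are polynomial identities.
module Submission where

open import Defs
open import Data.Bool using (if_then_else_)
open import Data.Nat
open import Data.Nat.DivMod using (_/_; _%_; m*n/n≡m; m*n%n≡0; [m+kn]%n≡m%n)
open import Data.Nat.Properties
open import Data.Nat.Tactic.RingSolver using (solve-∀)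
open import Data.Integer as ℤ using (ℤ; +_; 1ℤ; 0ℤ; _-_; -_)
open import Data.Integer.Properties using (pos-*)
import Data.Integer.Tactic.RingSolver as ℤ-Ring
open import Data.Product using (Σ; Σ-syntax; _×_; _,_; proj₁)
open import Relation.Binary.PropositionalEquality
  using (_≡_; refl; sym; trans; cong; cong₂; subst; subst₂; module ≡-Reasoning)
open import Relation.Nullary using (Dec; yes; no; does; contradiction)

IsFloorSqrt : ℕ → ℕ → Set
IsFloorSqrt C t = t * t ≤ C × C < suc t * suc t

floorSqrt-correct : ∀ C → IsFloorSqrt C (floorSqrt C)
floorSqrt-correct zero = z≤n , s≤s z≤n
floorSqrt-correct (suc C) = step (suc t * suc t ≤? suc C) (floorSqrt-correct C)
  where
  t = floorSqrt C
  step : (d : Dec (suc t * suc t ≤ suc C)) → IsFloorSqrt C t →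
         IsFloorSqrt (suc C) (if does d then suc t else t)
  step (yes [1+t]²≤1+C) (_ , C<[1+t]²) =
    [1+t]²≤1+C , ≤-<-trans C<[1+t]² (*-mono-< (n<1+n (suc t)) (n<1+n (suc t)))
  step (no [1+t]²≰1+C) (t²≤C , _) = m≤n⇒m≤1+n t²≤C , ≰⇒> [1+t]²≰1+C

isFloorSqrt-≤ : ∀ {C t u} → IsFloorSqrt C t → IsFloorSqrt C u → t ≤ u
isFloorSqrt-≤ (t²≤C , _) (_ , C<[1+u]²) =
  ≮⇒≥ λ u<t → <⇒≱ C<[1+u]² (≤-trans (*-mono-≤ u<t u<t) t²≤C)

isFloorSqrt-unique : ∀ {C t u} → IsFloorSqrt C t → IsFloorSqrt C u → t ≡ u
isFloorSqrt-unique p q = ≤-antisym (isFloorSqrt-≤ p q) (isFloorSqrt-≤ q p)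

[1+t]²≡1+t²+2t : ∀ t → suc t * suc t ≡ suc (t * t + (t + t))
[1+t]²≡1+t²+2t = solve-∀

t²+r-isFloorSqrt : ∀ t {r} → r ≤ t + t → IsFloorSqrt (t * t + r) t
t²+r-isFloorSqrt t {r} r≤2t =
  m≤m+n (t * t) r , subst (t * t + r <_) (sym ([1+t]²≡1+t²+2t t)) (s≤s (+-monoʳ-≤ (t * t) r≤2t))

floorSqrt-t²+r : ∀ t {r} → r ≤ t + t → floorSqrt (t * t + r) ≡ t
floorSqrt-t²+r t r≤2t = isFloorSqrt-unique (floorSqrt-correct _) (t²+r-isFloorSqrt t r≤2t)

isFloorSqrt⇒C∸t²≤t+t : ∀ {C} t → IsFloorSqrt C t → C ∸ t * t ≤ t + t
isFloorSqrt⇒C∸t²≤t+t {C} t (_ , C<[1+t]²) = begin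
  C ∸ t * t                   ≤⟨ ∸-monoˡ-≤ (t * t) C≤t²+2t ⟩
  t * t + (t + t) ∸ t * t     ≡⟨ m+n∸m≡n (t * t) (t + t) ⟩
  t + t                       ∎
  where
  open ≤-Reasoning
  C≤t²+2t : C ≤ t * t + (t + t)
  C≤t²+2t = s≤s⁻¹ (subst (C <_) ([1+t]²≡1+t²+2t t) C<[1+t]²)

quarterSquare : ℕ → ℕ
quarterSquare s = (s * s ∸ s % 2) / 4

quarterSquare-even : ∀ t → quarterSquare (t * 2) ≡ t * t
quarterSquare-even t = begin
  (t * 2 * (t * 2) ∸ t * 2 % 2) / 4  ≡⟨ cong (λ k → (t * 2 * (t * 2) ∸ k) / 4) (m*n%n≡0 t 2) ⟩
  t * 2 * (t * 2) / 4                ≡⟨ cong (_/ 4) ([2t]²≡4t² t) ⟩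
  t * t * 4 / 4                      ≡⟨ m*n/n≡m (t * t) 4 ⟩
  t * t                              ∎
  where
  open ≡-Reasoning
  [2t]²≡4t² : ∀ t → t * 2 * (t * 2) ≡ t * t * 4
  [2t]²≡4t² = solve-∀

quarterSquare-odd : ∀ t → quarterSquare (suc (t * 2)) ≡ t * t + t
quarterSquare-odd t = begin
  (suc (t * 2) * suc (t * 2) ∸ suc (t * 2) % 2) / 4
    ≡⟨ cong (λ k → (suc (t * 2) * suc (t * 2) ∸ k) / 4) ([m+kn]%n≡m%n 1 t 2) ⟩
  (suc (t * 2) * suc (t * 2) ∸ 1) / 4
    ≡⟨ cong (λ k → (k ∸ 1) / 4) ([1+2t]²≡1+4[t²+t] t) ⟩
  (t * t + t) * 4 / 4
    ≡⟨ m*n/n≡m (t * t + t) 4 ⟩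
  t * t + t
    ∎
  where
  open ≡-Reasoning
  [1+2t]²≡1+4[t²+t] : ∀ t → suc (t * 2) * suc (t * 2) ≡ suc ((t * t + t) * 4)
  [1+2t]²≡1+4[t²+t] = solve-∀

n≤m⇒G≡quarterSquare+n : ∀ {m n} → n ≤ m → G m n ≡ quarterSquare (m + n + 1) + n
n≤m⇒G≡quarterSquare+n {m} {n} n≤m = cong (λ k → quarterSquare (m + n + 1) + k) (m≥n⇒m⊓n≡n n≤m)

data Halving : ℕ → Set where
  even : ∀ e → Halving (e + e)
  odd  : ∀ e → Halving (suc (e + e))

halve : ∀ d → Halving d
halve zero = even 0
halve (suc d) with halve d
... | even e = odd e
... | odd e = subst Halving (cong suc (+-suc e e)) (even (suc e))

data Gap : ℕ → ℕ → Set where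
  odd  : ∀ n e → Gap (n + suc (e + e)) n
  even : ∀ n e → Gap (n + (e + e)) n

gap : ∀ {m n} → n ≤ m → Gap m n
gap {m} {n} n≤m = subst (λ k → Gap k n) (m+[n∸m]≡n n≤m) (gap-+ (m ∸ n))
  where
  gap-+ : ∀ d → Gap (n + d) n
  gap-+ d with halve d
  ... | even e = even n e
  ... | odd e = odd n e

gap⇒≤ : ∀ {m n} → Gap m n → n ≤ m
gap⇒≤ (odd n e) = m≤m+n n _
gap⇒≤ (even n e) = m≤m+n n _

root : ∀ {m n} → Gap m n → ℕ
root (odd n e) = suc (n + e)
root (even n e) = n + e

rem : ∀ {m n} → Gap m n → ℕ
rem (odd n e) = n
rem (even n e) = n + e + n

rem≤root+root : ∀ {m n} (g : Gap m n) → rem g ≤ root g + root g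
rem≤root+root (odd n e) = ≤-trans (m≤m+n n e) (≤-trans (n≤1+n (n + e)) (m≤m+n _ _))
rem≤root+root (even n e) = +-monoʳ-≤ (n + e) (m≤m+n n e)

G-gap : ∀ {m n} (g : Gap m n) → G m n ≡ root g * root g + rem g
G-gap (odd n e) = begin
  G m n                          ≡⟨ n≤m⇒G≡quarterSquare+n n≤m ⟩
  quarterSquare (m + n + 1) + n  ≡⟨ cong (λ s → quarterSquare s + n) (sum≡2t n e) ⟩
  quarterSquare (t * 2) + n      ≡⟨ cong (_+ n) (quarterSquare-even t) ⟩
  t * t + n                      ∎
  where
  open ≡-Reasoning
  m = n + suc (e + e)
  t = suc (n + e)
  n≤m : n ≤ m
  n≤m = m≤m+n n (suc (e + e))
  sum≡2t : ∀ n e → n + suc (e + e) + n + 1 ≡ suc (n + e) * 2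
  sum≡2t = solve-∀
G-gap (even n e) = begin
  G m n                            ≡⟨ n≤m⇒G≡quarterSquare+n n≤m ⟩
  quarterSquare (m + n + 1) + n    ≡⟨ cong (λ s → quarterSquare s + n) (sum≡1+2t n e) ⟩
  quarterSquare (suc (t * 2)) + n  ≡⟨ cong (_+ n) (quarterSquare-odd t) ⟩
  t * t + t + n                    ≡⟨ +-assoc (t * t) t n ⟩
  t * t + (t + n)                  ∎
  where
  open ≡-Reasoning
  m = n + (e + e)
  t = n + e
  n≤m : n ≤ m
  n≤m = m≤m+n n (e + e)
  sum≡1+2t : ∀ n e → n + (e + e) + n + 1 ≡ suc ((n + e) * 2)
  sum≡1+2t = solve-∀

floorSqrt-G : ∀ {m n} (g : Gap m n) → floorSqrt (G m n) ≡ root g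
floorSqrt-G g = trans (cong floorSqrt (G-gap g)) (floorSqrt-t²+r (root g) (rem≤root+root g))

root-rem-injective : ∀ {m n m′ n′} (g : Gap m n) (g′ : Gap m′ n′) →
                     root g ≡ root g′ → rem g ≡ rem g′ → m ≡ m′ × n ≡ n′
root-rem-injective (odd n e) (odd .n e′) root≡ refl
  rewrite +-cancelˡ-≡ n e e′ (suc-injective root≡) = refl , refl
root-rem-injective (even n e) (even n′ e′) root≡ rem≡
  with +-cancelˡ-≡ (n′ + e′) n n′ (trans (cong (_+ n) (sym root≡)) rem≡)
... | refl rewrite +-cancelˡ-≡ n e e′ root≡ = refl , refl
-- An odd gap has rem < root, an even one root ≤ rem.
root-rem-injective (odd n e) (even n′ e′) root≡ rem≡ =
  contradiction (subst₂ _≤_ (sym root≡) (sym rem≡) (m≤m+n (n′ + e′) n′)) (<⇒≱ (s≤s (m≤m+n n e)))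
root-rem-injective (even n e) (odd n′ e′) root≡ rem≡ =
  contradiction (subst₂ _≤_ root≡ rem≡ (m≤m+n (n + e) n)) (<⇒≱ (s≤s (m≤m+n n′ e′)))

G-injective : ∀ {m n m′ n′} (g : Gap m n) (g′ : Gap m′ n′) →
              G m n ≡ G m′ n′ → m ≡ m′ × n ≡ n′
G-injective {m} {n} {m′} {n′} g g′ G≡ =
  root-rem-injective g g′ root≡ (+-cancelˡ-≡ (root g * root g) (rem g) (rem g′) t²+rem≡)
  where
  open ≡-Reasoning
  root≡ : root g ≡ root g′
  root≡ = begin
    root g             ≡⟨ floorSqrt-G g ⟨
    floorSqrt (G m n)    ≡⟨ cong floorSqrt G≡ ⟩
    floorSqrt (G m′ n′)  ≡⟨ floorSqrt-G g′ ⟩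
    root g′            ∎
  t²+rem≡ : root g * root g + rem g ≡ root g * root g + rem g′
  t²+rem≡ = begin
    root g * root g + rem g     ≡⟨ G-gap g ⟨
    G m n                       ≡⟨ G≡ ⟩
    G m′ n′                     ≡⟨ G-gap g′ ⟩
    root g′ * root g′ + rem g′  ≡⟨ cong (λ t → t * t + rem g′) root≡ ⟨
    root g * root g + rem g′    ∎

gap-with-root-rem : ∀ t r → r ≤ t + t →
                    Σ[ (m , n) ∈ ℕ × ℕ ] Σ[ g ∈ Gap m n ] (root g ≡ t × rem g ≡ r)
gap-with-root-rem t r r≤2t with r <? t
... | yes r<t = _ , odd r (t ∸ suc r) , m+[n∸m]≡n r<t , refl
... | no r≮t = _ , even n (t ∸ n) , n+e≡t , trans (cong (_+ n) n+e≡t) t+n≡r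
  where
  n = r ∸ t
  t+n≡r : t + n ≡ r
  t+n≡r = m+[n∸m]≡n (≮⇒≥ r≮t)
  n≤t : n ≤ t
  n≤t = +-cancelˡ-≤ t n t (subst (_≤ t + t) (sym t+n≡r) r≤2t)
  n+e≡t : n + (t ∸ n) ≡ t
  n+e≡t = m+[n∸m]≡n n≤t

G-surjective : ∀ C → Σ[ (m , n) ∈ ℕ × ℕ ] (Gap m n × G m n ≡ C)
G-surjective C =
  let (m , n) , g , root≡t , rem≡r =
        gap-with-root-rem t (C ∸ t * t) (isFloorSqrt⇒C∸t²≤t+t t t-correct)
  in (m , n) , g , (begin
    G m n                    ≡⟨ G-gap g ⟩
    root g * root g + rem g  ≡⟨ cong₂ (λ t r → t * t + r) root≡t rem≡r ⟩
    t * t + (C ∸ t * t)      ≡⟨ m+[n∸m]≡n (proj₁ t-correct) ⟩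
    C                        ∎)
  where
  open ≡-Reasoning
  t = floorSqrt C
  t-correct : IsFloorSqrt C t
  t-correct = floorSqrt-correct C

-- formulaM C and formulaN C are, definitionally, atRoot mPoly and atRoot nPoly at
-- T = + floorSqrt C and Cz = + C. The ring identities below spell mPoly and nPoly out,
-- as the solver does not unfold definitions.
mPoly nPoly : (c a b T Cz : ℤ) → ℤ
mPoly c a b T Cz = c ℤ.* ((+ 2 ℤ.* T - 1ℤ) ℤ.* (1ℤ - a)
                          ℤ.+ a ℤ.* (T ℤ.* (T ℤ.+ + 3) - (T ℤ.+ 1ℤ) ℤ.* b - Cz))
nPoly c a b T Cz = c ℤ.* a ℤ.* (Cz - T ℤ.* (T ℤ.+ 1ℤ - b))

atRoot : (ℤ → ℤ → ℤ → ℤ → ℤ → ℤ) → ℤ → ℤ → ℤ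
atRoot P T Cz = P (sgn T) (sgn (Cz - T ℤ.* T)) (sgn′ (T ℤ.* T ℤ.+ T - Cz)) T Cz

atRoot-t²+r : ∀ P t r → r ≤ t + t → let T = + t; R = + r in
              atRoot P (+ floorSqrt (t * t + r)) (+ (t * t + r))
              ≡ P (sgn T) (sgn R) (sgn′ (T - R)) T (T ℤ.* T ℤ.+ R)
atRoot-t²+r P t r r≤2t = begin
  atRoot P (+ floorSqrt (t * t + r)) (+ (t * t + r))
    ≡⟨ cong (λ u → atRoot P (+ u) (+ (t * t + r))) (floorSqrt-t²+r t r≤2t) ⟩
  atRoot P T (+ (t * t) ℤ.+ R)
    ≡⟨ cong (λ x → atRoot P T (x ℤ.+ R)) (pos-* t t) ⟩
  atRoot P T (T ℤ.* T ℤ.+ R)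
    ≡⟨ cong₂ (λ a b → P (sgn T) a b T (T ℤ.* T ℤ.+ R))
             (cong sgn (T²+R-T²≡R T R)) (cong sgn′ (T²+T-[T²+R]≡T-R T R)) ⟩
  P (sgn T) (sgn R) (sgn′ (T - R)) T (T ℤ.* T ℤ.+ R)
    ∎
  where
  open ≡-Reasoning
  T = + t
  R = + r
  T²+R-T²≡R : ∀ T R → T ℤ.* T ℤ.+ R - T ℤ.* T ≡ R
  T²+R-T²≡R = ℤ-Ring.solve-∀
  T²+T-[T²+R]≡T-R : ∀ T R → T ℤ.* T ℤ.+ T - (T ℤ.* T ℤ.+ R) ≡ T - R
  T²+T-[T²+R]≡T-R = ℤ-Ring.solve-∀

formulas-t²+r : ∀ t r {m n c a b} → r ≤ t + t → let T = + t; R = + r in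
                sgn T ≡ c → sgn R ≡ a → sgn′ (T - R) ≡ b →
                mPoly c a b T (T ℤ.* T ℤ.+ R) ≡ + m →
                nPoly c a b T (T ℤ.* T ℤ.+ R) ≡ + n →
                + m ≡ formulaM (t * t + r) × + n ≡ formulaN (t * t + r)
formulas-t²+r t r r≤2t refl refl refl mPoly≡m nPoly≡n =
    sym (trans (atRoot-t²+r mPoly t r r≤2t) mPoly≡m)
  , sym (trans (atRoot-t²+r nPoly t r r≤2t) nPoly≡n)

sgn-pos : ∀ {k} → 0 < k → sgn (+ k) ≡ 1ℤ
sgn-pos {suc k} _ = refl

sgn′-nonpos : ∀ n → sgn′ (- + n) ≡ 0ℤ
sgn′-nonpos zero = refl
sgn′-nonpos (suc n) = refl

formulas-odd : ∀ n e → let g = odd n e in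
               + (n + suc (e + e)) ≡ formulaM (root g * root g + rem g)
               × + n ≡ formulaN (root g * root g + rem g)
formulas-odd zero e = formulas-t²+r (suc e) 0 z≤n refl refl refl (mPoly-odd₀ (+ e)) refl
  where
  mPoly-odd₀ : ∀ E → let T = 1ℤ ℤ.+ E in
    1ℤ ℤ.* ((+ 2 ℤ.* T - 1ℤ) ℤ.* (1ℤ - 0ℤ)
            ℤ.+ 0ℤ ℤ.* (T ℤ.* (T ℤ.+ + 3) - (T ℤ.+ 1ℤ) ℤ.* 1ℤ - (T ℤ.* T ℤ.+ 0ℤ)))
    ≡ 1ℤ ℤ.+ (E ℤ.+ E)
  mPoly-odd₀ = ℤ-Ring.solve-∀
formulas-odd (suc n) e = formulas-t²+r (suc (suc n + e)) (suc n) (rem≤root+root (odd (suc n) e))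
  refl refl (cong sgn′ (T-N≡1+E N E)) (mPoly-odd N E) (nPoly-odd N E)
  where
  N = + suc n
  E = + e
  T-N≡1+E : ∀ N E → 1ℤ ℤ.+ (N ℤ.+ E) - N ≡ 1ℤ ℤ.+ E
  T-N≡1+E = ℤ-Ring.solve-∀
  mPoly-odd : ∀ N E → let T = 1ℤ ℤ.+ (N ℤ.+ E) in
    1ℤ ℤ.* ((+ 2 ℤ.* T - 1ℤ) ℤ.* (1ℤ - 1ℤ)
            ℤ.+ 1ℤ ℤ.* (T ℤ.* (T ℤ.+ + 3) - (T ℤ.+ 1ℤ) ℤ.* 1ℤ - (T ℤ.* T ℤ.+ N)))
    ≡ N ℤ.+ (1ℤ ℤ.+ (E ℤ.+ E))
  mPoly-odd = ℤ-Ring.solve-∀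
  nPoly-odd : ∀ N E → let T = 1ℤ ℤ.+ (N ℤ.+ E) in
    1ℤ ℤ.* 1ℤ ℤ.* (T ℤ.* T ℤ.+ N - T ℤ.* (T ℤ.+ 1ℤ - 1ℤ)) ≡ N
  nPoly-odd = ℤ-Ring.solve-∀

formulas-even : ∀ n e → 0 < n + e → let g = even n e in
                + (n + (e + e)) ≡ formulaM (root g * root g + rem g)
                × + n ≡ formulaN (root g * root g + rem g)
formulas-even n e 0<t = formulas-t²+r t (t + n) (rem≤root+root (even n e))
  (sgn-pos 0<t) (sgn-pos (≤-trans 0<t (m≤m+n t n)))
  (trans (cong sgn′ (T-[T+N]≡-N (+ t) N)) (sgn′-nonpos n))
  (mPoly-even N E) (nPoly-even N E)
  where
  t = n + e
  N = + n
  E = + e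
  T-[T+N]≡-N : ∀ T N → T - (T ℤ.+ N) ≡ - N
  T-[T+N]≡-N = ℤ-Ring.solve-∀
  mPoly-even : ∀ N E → let T = N ℤ.+ E in
    1ℤ ℤ.* ((+ 2 ℤ.* T - 1ℤ) ℤ.* (1ℤ - 1ℤ)
            ℤ.+ 1ℤ ℤ.* (T ℤ.* (T ℤ.+ + 3) - (T ℤ.+ 1ℤ) ℤ.* 0ℤ - (T ℤ.* T ℤ.+ (T ℤ.+ N))))
    ≡ N ℤ.+ (E ℤ.+ E)
  mPoly-even = ℤ-Ring.solve-∀
  nPoly-even : ∀ N E → let T = N ℤ.+ E in
    1ℤ ℤ.* 1ℤ ℤ.* (T ℤ.* T ℤ.+ (T ℤ.+ N) - T ℤ.* (T ℤ.+ 1ℤ - 0ℤ)) ≡ N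
  nPoly-even = ℤ-Ring.solve-∀

gap-formulas : ∀ {m n} (g : Gap m n) → + m ≡ formulaM (G m n) × + n ≡ formulaN (G m n)
gap-formulas {m} {n} g =
  subst (λ C → + m ≡ formulaM C × + n ≡ formulaN C) (sym (G-gap g)) (t²+r-formulas g)
  where
  t²+r-formulas : ∀ {m n} (g : Gap m n) →
                  + m ≡ formulaM (root g * root g + rem g)
                  × + n ≡ formulaN (root g * root g + rem g)
  t²+r-formulas (odd n e) = formulas-odd n e
  t²+r-formulas (even zero zero) = refl , refl
  t²+r-formulas (even zero (suc e)) = formulas-even zero (suc e) z<s
  t²+r-formulas (even (suc n) e) = formulas-even (suc n) e z<s

corollary2 : (C : ℕ) →
    Σ (ℕ × ℕ) λ { (m , n) →
      (n ≤ m × G m n ≡ C)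
      × ((m' n' : ℕ) → n' ≤ m' → G m' n' ≡ C → (m' ≡ m × n' ≡ n))
      × (+ m ≡ formulaM C × + n ≡ formulaN C) }
corollary2 C with G-surjective C
... | (m , n) , g , refl =
  (m , n) , (gap⇒≤ g , refl)
  , (λ m′ n′ n′≤m′ G≡ → G-injective (gap n′≤m′) g G≡)
  , gap-formulas g
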